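{- Let $X$ be a finite quandle with connected components $C_1,\dots,C_k$, let $s=(x_1,\dots,x_n)\in X^n$, put $D_j=\{i:x_i\in C_j\}$, $n_j=|D_j|$, identify $S_{n_1}\times\dots\times S_{n_k}$ with $\{\sigma\in S_n:\sigma(D_j)=D_j\ \forall j\}$, and let $N=\max_j|C_j|$. If $n_j>N$ for every $1\le j\le k$, then the image in $S_{n_1}\times\dots\times S_{n_k}$ of the stabilizer of $s$ in $B_{n_1,\dots,n_k}$ surjects onto $(\mathbb Z/2\mathbb Z)^k$ under the product of the sign homomorphisms $S_{n_j}\to\mathbb Z/2\mathbb Z$.
   Context: Quandle: set with $(x,y)\mapsto x^y$, each $x\mapsto x^y$ bijective, $(z^x)^y=(z^y)^{x^y}$, $x^x=x$. Connected components: orbits of the group generated by the maps $x\mapsto x^y$. $B_n$ acts on $X^n$ on the right by $(\dots,c_i,c_{i+1},\dots)^{\sigma_i}=(\dots,c_{i+1},c_i^{c_{i+1}},\dots)$; $B_n\to S_n$ sends $\sigma_i\mapsto(i\ i+1)$; $B_{n_1,\dots,n_k}$ is the preimage of $S_{n_1}\times\dots\times S_{n_k}$ in $B_n$. -}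

module Defs where

open import Data.Nat using (ℕ; zero; suc; _+_; _<_; _⊔_)
open import Data.Nat.Properties using (≤-trans; n≤1+n)
open import Data.Fin using (Fin; zero; suc; fromℕ<; _≟_; _<?_)
open import Data.Bool using (Bool; true; false; if_then_else_; _∧_)
open import Data.List using (List; []; _∷_)
open import Data.Product using (∃; _×_)
open import Data.Sum using (_⊎_)
open import Function using (_∘_; id)
open import Function.Bundles using (_⇔_)
open import Relation.Nullary.Decidable using (⌊_⌋)
open import Relation.Binary.PropositionalEquality using (_≡_)
open import Relation.Binary.Construct.Closure.ReflexiveTransitive using (Star)

-- Finite quandles, with carrier Fin m.  x ▷ y stands for x^y.
-- Bijectivity of x ↦ x^y is given by an explicit two-sided inverse ▷⁻.

record Quandle (m : ℕ) : Set where
  infixl 7 _▷_ _▷⁻_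
  field
    _▷_   : Fin m → Fin m → Fin m
    _▷⁻_  : Fin m → Fin m → Fin m
    ▷⁻▷   : ∀ x y → (x ▷⁻ y) ▷ y ≡ x
    ▷▷⁻   : ∀ x y → (x ▷ y) ▷⁻ y ≡ x
    selfdistr : ∀ x y z → (z ▷ x) ▷ y ≡ (z ▷ y) ▷ (x ▷ y)
    idem  : ∀ x → x ▷ x ≡ x

module _ {m : ℕ} (Q : Quandle m) where
  open Quandle Q

  Step : Fin m → Fin m → Set
  Step x y = ∃ λ z → (y ≡ x ▷ z) ⊎ (x ≡ y ▷ z)

  -- x and y lie in the same orbit of the group generated by the maps ·^z
  Connected : Fin m → Fin m → Set
  Connected = Star Step

  record IsComponentLabelling (k : ℕ) (comp : Fin m → Fin k) : Set where
    field
      sameComp : ∀ x y → (comp x ≡ comp y) ⇔ Connected x y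
      surj     : ∀ j → ∃ λ x → comp x ≡ j

count : ∀ {n} → (Fin n → Bool) → ℕ
count {zero}  f = 0
count {suc n} f = (if f zero then 1 else 0) + count (f ∘ suc)

sumF : ∀ {n} → (Fin n → ℕ) → ℕ
sumF {zero}  f = 0
sumF {suc n} f = f zero + sumF (f ∘ suc)

maxF : ∀ {n} → (Fin n → ℕ) → ℕ
maxF {zero}  f = 0
maxF {suc n} f = f zero ⊔ maxF (f ∘ suc)

-- Braid words: letters σ_i^{±1} (i = idx, 0-based, idx+1 < n)

record Gen (n : ℕ) : Set where
  constructor gen
  field
    idx : ℕ
    lt  : suc idx < n
    inv : Bool   -- true = σ_i^{-1}

module _ {n : ℕ} (g : Gen n) where
  open Gen g
  posL : Fin n
  posL = fromℕ< (≤-trans (n≤1+n (suc idx)) lt)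
  posR : Fin n
  posR = fromℕ< lt

  transp : Fin n → Fin n
  transp p = if ⌊ p ≟ posL ⌋ then posR else (if ⌊ p ≟ posR ⌋ then posL else p)

BraidWord : ℕ → Set
BraidWord n = List (Gen n)

perm : ∀ {n} → BraidWord n → Fin n → Fin n
perm []      = id
perm (g ∷ w) = transp g ∘ perm w

module _ {m : ℕ} (Q : Quandle m) where
  open Quandle Q

  -- right action of one letter on X^n:
  -- σ_i   : (.., c_i, c_{i+1}, ..) ↦ (.., c_{i+1}, c_i ▷ c_{i+1}, ..)
  -- σ_i⁻¹ : (.., d_i, d_{i+1}, ..) ↦ (.., d_{i+1} ▷⁻ d_i, d_i, ..)
  act1 : ∀ {n} → Gen n → (Fin n → Fin m) → (Fin n → Fin m)
  act1 g s p with Gen.inv g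
  ... | false = if ⌊ p ≟ posL g ⌋ then s (posR g)
                else (if ⌊ p ≟ posR g ⌋ then s (posL g) ▷ s (posR g) else s p)
  ... | true  = if ⌊ p ≟ posL g ⌋ then s (posR g) ▷⁻ s (posL g)
                else (if ⌊ p ≟ posR g ⌋ then s (posL g) else s p)

  act : ∀ {n} → (Fin n → Fin m) → BraidWord n → (Fin n → Fin m)
  act s []      = s
  act s (g ∷ w) = act (act1 g s) w

-- Sign of the restriction of a permutation π of Fin n to a subset D
-- (D preserved by π), as the parity of the number of inversions of π within D.

inversionsOn : ∀ {n} → (Fin n → Bool) → (Fin n → Fin n) → ℕ
inversionsOn D π =
  sumF (λ a → count (λ b → ⌊ a <? b ⌋ ∧ D a ∧ D b ∧ ⌊ π b <? π a ⌋))

-- More than |C_j| positions of s carry entries from C_j, so by pigeonhole two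
-- positions a < b of D_j carry the same entry. Sliding the entry at b down next to a,
-- applying σ_a (which fixes the equal pair since x ▷ x = x) and sliding back gives a braid
-- stabilizing s whose permutation is the transposition (a b): odd on D_j, trivial off D_j.
-- Concatenating such braids over the j with ε j = 1 realizes every sign vector. Stabilizing
-- braids preserve each D_j because every entry of s^w is connected to an entry of s.
module Submission where

open import Defs
open import Data.Bool using (Bool; true; false; if_then_else_; _∧_; not)
open import Data.Bool.Properties using (∧-identityʳ; ∧-zeroʳ; ∧-comm; ∧-assoc)
open import Data.Fin as Fin using (Fin; zero; suc; toℕ; _≟_; _<?_)
import Data.Fin.Properties as Finₚ
open import Data.Nat as ℕ using (ℕ; zero; suc; _+_; _*_; _<_; _%_; z≤n; s≤s)
open import Data.Nat.DivMod using ([m+kn]%n≡m%n)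
import Data.Nat.Properties as ℕₚ
open import Algebra.Properties.CommutativeSemigroup ℕₚ.+-commutativeSemigroup using (interchange)
open import Data.List using ([]; _∷_; _++_; _∷ʳ_; concat; tabulate)
open import Data.Product using (∃; ∃₂; _×_; _,_; proj₁; proj₂)
open import Data.Sum using (inj₁; inj₂)
open import Data.Empty using (⊥; ⊥-elim)
open import Function using (_∘_; id)
open import Function.Bundles using (Equivalence)
open import Function.Definitions using (Injective)
open import Relation.Nullary using (¬_; yes; no; Dec; contradiction)
open import Relation.Nullary.Decidable using (⌊_⌋)
open import Relation.Binary.PropositionalEquality
import Relation.Binary.Construct.Closure.ReflexiveTransitive as Star
open Star using (_◅_; _◅◅_)

private
  variable
    m n k k′ : ℕ

indicator : Bool → ℕ
indicator b = if b then 1 else 0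

⌊⌋-true : {A : Set} (a? : Dec A) → A → ⌊ a? ⌋ ≡ true
⌊⌋-true (yes _) _ = refl
⌊⌋-true (no ¬a) a = contradiction a ¬a

⌊⌋-false : {A : Set} (a? : Dec A) → ¬ A → ⌊ a? ⌋ ≡ false
⌊⌋-false (yes a) ¬a = contradiction a ¬a
⌊⌋-false (no _)  _  = refl

⌊⌋-true⁻¹ : {A : Set} (a? : Dec A) → ⌊ a? ⌋ ≡ true → A
⌊⌋-true⁻¹ (yes a) _ = a

count≡sumF : (P : Fin n → Bool) → count P ≡ sumF (indicator ∘ P)
count≡sumF {zero}  P = refl
count≡sumF {suc n} P = cong (indicator (P zero) +_) (count≡sumF (P ∘ suc))

sumF-cong : {f g : Fin n → ℕ} → f ≗ g → sumF f ≡ sumF g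
sumF-cong {zero}  f≗g = refl
sumF-cong {suc n} f≗g = cong₂ _+_ (f≗g zero) (sumF-cong (f≗g ∘ suc))

count-cong : {P P′ : Fin n → Bool} → P ≗ P′ → count P ≡ count P′
count-cong {zero}  P≗P′ = refl
count-cong {suc n} P≗P′ = cong₂ (λ b c → indicator b + c) (P≗P′ zero) (count-cong (P≗P′ ∘ suc))

sumF-+ : (f g : Fin n → ℕ) → sumF (λ x → f x + g x) ≡ sumF f + sumF g
sumF-+ {zero}  f g = refl
sumF-+ {suc n} f g = trans (cong (f zero + g zero +_) (sumF-+ (f ∘ suc) (g ∘ suc)))
                           (interchange (f zero) (g zero) _ _)

sumF-zero : {f : Fin n → ℕ} → (∀ x → f x ≡ 0) → sumF f ≡ 0
sumF-zero {zero}  f≡0 = refl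
sumF-zero {suc n} f≡0 = cong₂ _+_ (f≡0 zero) (sumF-zero (f≡0 ∘ suc))

sumF-single : {f : Fin n → ℕ} (c : Fin n) → (∀ x → x ≢ c → f x ≡ 0) → sumF f ≡ f c
sumF-single {f = f} zero    f≡0 =
  trans (cong (f zero +_) (sumF-zero (λ x → f≡0 (suc x) λ ()))) (ℕₚ.+-identityʳ _)
sumF-single {f = f} (suc c) f≡0 =
  cong₂ _+_ (f≡0 zero λ ()) (sumF-single c λ x x≢c → f≡0 (suc x) (x≢c ∘ Finₚ.suc-injective))

≤-maxF : (f : Fin n → ℕ) (j : Fin n) → f j ℕ.≤ maxF f
≤-maxF f zero    = ℕₚ.m≤m⊔n _ _
≤-maxF f (suc j) = ℕₚ.≤-trans (≤-maxF (f ∘ suc) j) (ℕₚ.m≤n⊔m _ _)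

count-remove : (P : Fin m → Bool) (v : Fin m) → P v ≡ true
  → count P ≡ suc (count (λ x → P x ∧ not ⌊ x ≟ v ⌋))
count-remove P v Pv = begin
  count P
    ≡⟨ count≡sumF P ⟩
  sumF (indicator ∘ P)
    ≡⟨ sumF-cong split ⟩
  sumF (λ x → indicator ⌊ x ≟ v ⌋ + indicator (P′ x))
    ≡⟨ sumF-+ (λ x → indicator ⌊ x ≟ v ⌋) (indicator ∘ P′) ⟩
  sumF (λ x → indicator ⌊ x ≟ v ⌋) + sumF (indicator ∘ P′)
    ≡⟨ cong₂ _+_ (sumF-single v λ x x≢v → cong indicator (⌊⌋-false (x ≟ v) x≢v))
                 (sym (count≡sumF P′)) ⟩
  indicator ⌊ v ≟ v ⌋ + count P′
    ≡⟨ cong (λ b → indicator b + count P′) (⌊⌋-true (v ≟ v) refl) ⟩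
  suc (count P′)
    ∎
  where
  open ≡-Reasoning
  P′ : Fin _ → Bool
  P′ x = P x ∧ not ⌊ x ≟ v ⌋
  split : ∀ x → indicator (P x) ≡ indicator ⌊ x ≟ v ⌋ + indicator (P′ x)
  split x with x ≟ v
  ... | yes refl rewrite Pv = refl
  ... | no _     = cong indicator (sym (∧-identityʳ (P x)))

∧-true⇒ˡ : {x y : Bool} → x ∧ y ≡ true → x ≡ true
∧-true⇒ˡ {true} _ = refl

pigeonhole-count : (f : Fin n → Fin m) (P : Fin m → Bool) → count P < count (P ∘ f)
  → ∃₂ λ a b → a Fin.< b × f a ≡ f b × P (f a) ≡ true
pigeonhole-count {zero} f P ()
pigeonhole-count {suc n} f P h with P (f zero) in Pf₀ | Finₚ.any? (λ b → f (suc b) ≟ f zero)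
... | false | _
  with a , b , a<b , fa≡fb , Pfa ← pigeonhole-count (f ∘ suc) P h
  = suc a , suc b , s≤s a<b , fa≡fb , Pfa
... | true | yes (b , fb≡f₀) = zero , suc b , s≤s z≤n , sym fb≡f₀ , Pf₀
-- f zero is the only preimage of itself: drop it from the pigeonholes and recurse.
... | true | no f₀-fresh = lift (pigeonhole-count (f ∘ suc) P′ h′)
  where
  P′ : Fin _ → Bool
  P′ x = P x ∧ not ⌊ x ≟ f zero ⌋
  P≗P′ : ∀ x → P (f (suc x)) ≡ P′ (f (suc x))
  P≗P′ x rewrite ⌊⌋-false (f (suc x) ≟ f zero) (λ e → f₀-fresh (x , e)) = sym (∧-identityʳ _)
  h′ : count P′ < count (P′ ∘ f ∘ suc)
  h′ = subst₂ ℕ._≤_ (count-remove P (f zero) Pf₀) (count-cong P≗P′) (ℕ.s≤s⁻¹ h)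
  lift : (∃₂ λ a b → a Fin.< b × f (suc a) ≡ f (suc b) × P′ (f (suc a)) ≡ true)
       → ∃₂ λ a b → a Fin.< b × f a ≡ f b × P (f a) ≡ true
  lift (a , b , a<b , fa≡fb , P′fa) = suc a , suc b , s≤s a<b , fa≡fb , ∧-true⇒ˡ P′fa

record Swaps (π : Fin n → Fin n) (x y : Fin n) : Set where
  field
    image-x : π x ≡ y
    image-y : π y ≡ x
    fixes   : ∀ p → p ≢ x → p ≢ y → π p ≡ p

module _ {π : Fin n → Fin n} {x y : Fin n} (π-swaps : Swaps π x y) where
  open Swaps π-swaps

  swaps-involutive : ∀ p → π (π p) ≡ p
  swaps-involutive p with p ≟ x | p ≟ y
  ... | yes refl | _        = trans (cong π image-x) image-y
  ... | no _     | yes refl = trans (cong π image-y) image-x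
  ... | no p≢x   | no p≢y   = trans (cong π (fixes p p≢x p≢y)) (fixes p p≢x p≢y)

  swaps-conjugate : (ρ ρ⁻¹ : Fin n → Fin n) → ρ ∘ ρ⁻¹ ≗ id → ρ⁻¹ ∘ ρ ≗ id
    → Swaps (ρ ∘ π ∘ ρ⁻¹) (ρ x) (ρ y)
  swaps-conjugate ρ ρ⁻¹ ρρ⁻¹ ρ⁻¹ρ = record
    { image-x = cong ρ (trans (cong π (ρ⁻¹ρ x)) image-x)
    ; image-y = cong ρ (trans (cong π (ρ⁻¹ρ y)) image-y)
    ; fixes   = λ p p≢ρx p≢ρy → trans
        (cong ρ (fixes (ρ⁻¹ p) (λ e → p≢ρx (moved e)) (λ e → p≢ρy (moved e))))
        (ρρ⁻¹ p)
    }
    where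
    moved : ∀ {p q} → ρ⁻¹ p ≡ q → p ≡ ρ q
    moved {p} e = trans (sym (ρρ⁻¹ p)) (cong ρ e)

swaps-resp-≗ : {π π′ : Fin n → Fin n} {x y : Fin n} → π ≗ π′ → Swaps π x y → Swaps π′ x y
swaps-resp-≗ π≗π′ π-swaps = record
  { image-x = trans (sym (π≗π′ _)) image-x
  ; image-y = trans (sym (π≗π′ _)) image-y
  ; fixes   = λ p p≢x p≢y → trans (sym (π≗π′ p)) (fixes p p≢x p≢y)
  }
  where open Swaps π-swaps

toℕ-posL : (g : Gen n) → toℕ (posL g) ≡ Gen.idx g
toℕ-posL g = Finₚ.toℕ-fromℕ< _

toℕ-posR : (g : Gen n) → toℕ (posR g) ≡ suc (Gen.idx g)
toℕ-posR g = Finₚ.toℕ-fromℕ< _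

posR≢posL : (g : Gen n) → posR g ≢ posL g
posR≢posL g e = ℕₚ.1+n≢n (trans (sym (toℕ-posR g)) (trans (cong toℕ e) (toℕ-posL g)))

transp-swaps : (g : Gen n) → Swaps (transp g) (posL g) (posR g)
transp-swaps g = record { image-x = image-L ; image-y = image-R ; fixes = others }
  where
  image-L : transp g (posL g) ≡ posR g
  image-L rewrite ⌊⌋-true (posL g ≟ posL g) refl = refl
  image-R : transp g (posR g) ≡ posL g
  image-R rewrite ⌊⌋-false (posR g ≟ posL g) (posR≢posL g) | ⌊⌋-true (posR g ≟ posR g) refl = refl
  others : ∀ p → p ≢ posL g → p ≢ posR g → transp g p ≡ p
  others p p≢L p≢R rewrite ⌊⌋-false (p ≟ posL g) p≢L | ⌊⌋-false (p ≟ posR g) p≢R = refl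

σ : (i : ℕ) → suc i < n → Gen n
σ i i+1<n = gen i i+1<n false

flipGen : Gen n → Gen n
flipGen g = record g { inv = not (Gen.inv g) }

inverseWord : BraidWord n → BraidWord n
inverseWord []      = []
inverseWord (g ∷ w) = inverseWord w ∷ʳ flipGen g

perm-++ : (w w′ : BraidWord n) → perm (w ++ w′) ≗ perm w ∘ perm w′
perm-++ []      w′ p = refl
perm-++ (g ∷ w) w′ p = cong (transp g) (perm-++ w w′ p)

perm-inverseˡ : (w : BraidWord n) → perm (inverseWord w) ∘ perm w ≗ id
perm-inverseˡ []      p = refl
perm-inverseˡ (g ∷ w) p = begin
  perm (inverseWord w ∷ʳ flipGen g) (transp g (perm w p))
    ≡⟨ perm-++ (inverseWord w) _ _ ⟩
  perm (inverseWord w) (transp g (transp g (perm w p)))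
    ≡⟨ cong (perm (inverseWord w)) (swaps-involutive (transp-swaps g) _) ⟩
  perm (inverseWord w) (perm w p)
    ≡⟨ perm-inverseˡ w p ⟩
  p ∎
  where open ≡-Reasoning

perm-inverseʳ : (w : BraidWord n) → perm w ∘ perm (inverseWord w) ≗ id
perm-inverseʳ []      p = refl
perm-inverseʳ (g ∷ w) p = begin
  transp g (perm w (perm (inverseWord w ∷ʳ flipGen g) p))
    ≡⟨ cong (transp g ∘ perm w) (perm-++ (inverseWord w) _ p) ⟩
  transp g (perm w (perm (inverseWord w) (transp g p)))
    ≡⟨ cong (transp g) (perm-inverseʳ w _) ⟩
  transp g (transp g p)
    ≡⟨ swaps-involutive (transp-swaps g) p ⟩
  p ∎
  where open ≡-Reasoning

slide-bound : ∀ a d → suc (a + suc d) < n → suc (a + d) < n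
slide-bound {n} a d h = ℕₚ.<-trans (ℕₚ.n<1+n _) (subst (λ z → suc z < n) (ℕₚ.+-suc a d) h)

-- σ_{a+d} ⋯ σ_{a+1}: carries the entry at position a+1+d down to position a+1.
slide : ∀ a d → suc (a + d) < n → BraidWord n
slide a zero    h = []
slide a (suc d) h = σ (a + suc d) h ∷ slide a d (slide-bound a d h)

module _ {a d : ℕ} (h : suc (a + suc d) < n) {p : Fin n} (p≡a : toℕ p ≡ a) where
  private
    g : Gen n
    g = σ (a + suc d) h

  slide-start≢posL : p ≢ posL g
  slide-start≢posL e =
    ℕₚ.m≢1+m+n a (trans (sym p≡a) (trans (cong toℕ e) (trans (toℕ-posL g) (ℕₚ.+-suc a d))))

  slide-start≢posR : p ≢ posR g
  slide-start≢posR e = ℕₚ.m≢1+m+n a (trans (sym p≡a) (trans (cong toℕ e) (toℕ-posR g)))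

perm-slide-start : ∀ a d (h : suc (a + d) < n) {p} → toℕ p ≡ a → perm (slide a d h) p ≡ p
perm-slide-start a zero    h p≡a = refl
perm-slide-start a (suc d) h {p} p≡a =
  trans (cong (transp g) (perm-slide-start a d (slide-bound a d h) p≡a))
        (Swaps.fixes (transp-swaps g) p (slide-start≢posL {d = d} h p≡a) (slide-start≢posR {d = d} h p≡a))
  where
  g : Gen _
  g = σ (a + suc d) h

toℕ-perm-slide-next : ∀ a d (h : suc (a + d) < n) {p} → toℕ p ≡ suc a
  → toℕ (perm (slide a d h) p) ≡ suc (a + d)
toℕ-perm-slide-next a zero    h p≡1+a = trans p≡1+a (cong suc (sym (ℕₚ.+-identityʳ a)))
toℕ-perm-slide-next a (suc d) h p≡1+a = begin
  toℕ (transp g (perm (slide a d _) _)) ≡⟨ cong (toℕ ∘ transp g) (Finₚ.toℕ-injective reached) ⟩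
  toℕ (transp g (posL g))               ≡⟨ cong toℕ (Swaps.image-x (transp-swaps g)) ⟩
  toℕ (posR g)                          ≡⟨ toℕ-posR g ⟩
  suc (a + suc d)                       ∎
  where
  open ≡-Reasoning
  g : Gen _
  g = σ (a + suc d) h
  reached : toℕ (perm (slide a d (slide-bound a d h)) _) ≡ toℕ (posL g)
  reached = trans (toℕ-perm-slide-next a d _ p≡1+a) (trans (sym (ℕₚ.+-suc a d)) (sym (toℕ-posL g)))

module _ (Q : Quandle m) where
  open Quandle Q

  act1-other : (g : Gen n) (t : Fin n → Fin m) {p : Fin n}
    → p ≢ posL g → p ≢ posR g → act1 Q g t p ≡ t p
  act1-other g@(gen _ _ false) t {p} p≢L p≢R
    rewrite ⌊⌋-false (p ≟ posL g) p≢L | ⌊⌋-false (p ≟ posR g) p≢R = refl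
  act1-other g@(gen _ _ true) t {p} p≢L p≢R
    rewrite ⌊⌋-false (p ≟ posL g) p≢L | ⌊⌋-false (p ≟ posR g) p≢R = refl

  act1-cong : (g : Gen n) {t t′ : Fin n → Fin m} → t ≗ t′ → act1 Q g t ≗ act1 Q g t′
  act1-cong g@(gen _ _ false) t≗t′ p with ⌊ p ≟ posL g ⌋ | ⌊ p ≟ posR g ⌋
  ... | true  | _     = t≗t′ _
  ... | false | true  = cong₂ _▷_ (t≗t′ _) (t≗t′ _)
  ... | false | false = t≗t′ p
  act1-cong g@(gen _ _ true) t≗t′ p with ⌊ p ≟ posL g ⌋ | ⌊ p ≟ posR g ⌋
  ... | true  | _     = cong₂ _▷⁻_ (t≗t′ _) (t≗t′ _)
  ... | false | true  = t≗t′ _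
  ... | false | false = t≗t′ p

  act1-connected : (g : Gen n) (t : Fin n → Fin m) (p : Fin n)
    → Connected Q (t (transp g p)) (act1 Q g t p)
  act1-connected g@(gen _ _ false) t p with ⌊ p ≟ posL g ⌋ | ⌊ p ≟ posR g ⌋
  ... | true  | _     = Star.ε
  ... | false | true  = (t (posR g) , inj₁ refl) ◅ Star.ε
  ... | false | false = Star.ε
  act1-connected g@(gen _ _ true) t p with ⌊ p ≟ posL g ⌋ | ⌊ p ≟ posR g ⌋
  ... | true  | _     = (t (posL g) , inj₂ (sym (▷⁻▷ _ _))) ◅ Star.ε
  ... | false | true  = Star.ε
  ... | false | false = Star.ε

  act1-flip : (g : Gen n) (t : Fin n → Fin m) → act1 Q (flipGen g) (act1 Q g t) ≗ t
  act1-flip g t p with p ≟ posL g | p ≟ posR g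
  act1-flip g@(gen _ _ false) t p | yes refl | _
    rewrite ⌊⌋-true (p ≟ p) refl | ⌊⌋-false (posR g ≟ p) (posR≢posL g) | ⌊⌋-true (posR g ≟ posR g) refl
    = ▷▷⁻ _ _
  act1-flip g@(gen _ _ true) t p | yes refl | _
    rewrite ⌊⌋-true (p ≟ p) refl | ⌊⌋-false (posR g ≟ p) (posR≢posL g) | ⌊⌋-true (posR g ≟ posR g) refl
    = refl
  act1-flip g@(gen _ _ false) t p | no p≢L | yes refl
    rewrite ⌊⌋-false (p ≟ posL g) p≢L | ⌊⌋-true (p ≟ p) refl | ⌊⌋-true (posL g ≟ posL g) refl
    = refl
  act1-flip g@(gen _ _ true) t p | no p≢L | yes refl
    rewrite ⌊⌋-false (p ≟ posL g) p≢L | ⌊⌋-true (p ≟ p) refl | ⌊⌋-true (posL g ≟ posL g) refl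
    = ▷⁻▷ _ _
  act1-flip g t p | no p≢L | no p≢R =
    trans (act1-other (flipGen g) _ p≢L p≢R) (act1-other g t p≢L p≢R)

  act1-σ-equal : ∀ i (i+1<n : suc i < n) (t : Fin n → Fin m)
    → t (posL (σ i i+1<n)) ≡ t (posR (σ i i+1<n)) → act1 Q (σ i i+1<n) t ≗ t
  act1-σ-equal i i+1<n t tL≡tR p with p ≟ posL (σ i i+1<n)
  ... | yes refl = sym tL≡tR
  ... | no _ with p ≟ posR (σ i i+1<n)
  ...   | yes refl = trans (cong (_▷ t p) tL≡tR) (idem (t p))
  ...   | no _     = refl

  act-++ : (t : Fin n → Fin m) (w w′ : BraidWord n) → act Q t (w ++ w′) ≡ act Q (act Q t w) w′
  act-++ t []      w′ = refl
  act-++ t (g ∷ w) w′ = act-++ (act1 Q g t) w w′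

  act-cong : (w : BraidWord n) {t t′ : Fin n → Fin m} → t ≗ t′ → act Q t w ≗ act Q t′ w
  act-cong []      t≗t′ = t≗t′
  act-cong (g ∷ w) t≗t′ = act-cong w (act1-cong g t≗t′)

  act-inverse : (w : BraidWord n) (t : Fin n → Fin m) → act Q (act Q t w) (inverseWord w) ≗ t
  act-inverse []      t p = refl
  act-inverse (g ∷ w) t p
    rewrite act-++ (act Q (act1 Q g t) w) (inverseWord w) (flipGen g ∷ []) =
      trans (act1-cong (flipGen g) (act-inverse w (act1 Q g t)) p) (act1-flip g t p)

  act-connected : (w : BraidWord n) (t : Fin n → Fin m) (p : Fin n)
    → Connected Q (t (perm w p)) (act Q t w p)
  act-connected []      t p = Star.ε
  act-connected (g ∷ w) t p = act1-connected g t (perm w p) ◅◅ act-connected w (act1 Q g t) p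

  stabilizer-preserves-components : ∀ {k} {comp : Fin m → Fin k} → IsComponentLabelling Q k comp
    → (s : Fin n → Fin m) (w : BraidWord n) → act Q s w ≗ s → comp ∘ s ∘ perm w ≗ comp ∘ s
  stabilizer-preserves-components {comp = comp} labelling s w s^w≗s p =
    trans (Equivalence.from (sameComp _ _) (act-connected w s p)) (cong comp (s^w≗s p))
    where open IsComponentLabelling labelling

  act1-σ-posL : ∀ i (h : suc i < n) (t : Fin n → Fin m)
    → act1 Q (σ i h) t (posL (σ i h)) ≡ t (posR (σ i h))
  act1-σ-posL i h t rewrite ⌊⌋-true (posL (σ i h) ≟ posL (σ i h)) refl = refl

  act-slide-start : ∀ a d (h : suc (a + d) < n) (t : Fin n → Fin m) {p} → toℕ p ≡ a
    → act Q t (slide a d h) p ≡ t p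
  act-slide-start a zero    h t p≡a = refl
  act-slide-start a (suc d) h t p≡a =
    trans (act-slide-start a d (slide-bound a d h) (act1 Q g t) p≡a)
          (act1-other g t (slide-start≢posL {d = d} h p≡a) (slide-start≢posR {d = d} h p≡a))
    where
    g : Gen _
    g = σ (a + suc d) h

  act-slide-next : ∀ a d (h : suc (a + d) < n) (t : Fin n → Fin m) {p q}
    → toℕ p ≡ suc a → toℕ q ≡ suc (a + d) → act Q t (slide a d h) p ≡ t q
  act-slide-next a zero    h t p≡1+a q≡1+a+d =
    cong t (Finₚ.toℕ-injective (trans p≡1+a (trans (cong suc (sym (ℕₚ.+-identityʳ a))) (sym q≡1+a+d))))
  act-slide-next a (suc d) h t p≡1+a q≡1+a+d = begin
    act Q (act1 Q g t) (slide a d _) _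
      ≡⟨ act-slide-next a d _ (act1 Q g t) p≡1+a (trans (toℕ-posL g) (ℕₚ.+-suc a d)) ⟩
    act1 Q g t (posL g)
      ≡⟨ act1-σ-posL _ h t ⟩
    t (posR g)
      ≡⟨ cong t (Finₚ.toℕ-injective (trans (toℕ-posR g) (sym q≡1+a+d))) ⟩
    t _ ∎
    where
    open ≡-Reasoning
    g : Gen _
    g = σ (a + suc d) h


module _ {x y : Fin n} (x<y : x Fin.< y) where
  private
    a d : ℕ
    a = toℕ x
    d = proj₁ (ℕₚ.m≤n⇒∃[o]m+o≡n x<y)
    y≡1+a+d : toℕ y ≡ suc (a + d)
    y≡1+a+d = sym (proj₂ (ℕₚ.m≤n⇒∃[o]m+o≡n x<y))
    h : suc (a + d) < n
    h = subst (_< n) y≡1+a+d (Finₚ.toℕ<n y)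
    h₀ : suc a < n
    h₀ = ℕₚ.≤-<-trans (s≤s (ℕₚ.m≤m+n a d)) h
    M : BraidWord n
    M = slide a d h
    g₀ : Gen n
    g₀ = σ a h₀

  swapWord : BraidWord n
  swapWord = M ++ g₀ ∷ inverseWord M

  perm-swapWord : Swaps (perm swapWord) x y
  perm-swapWord = swaps-resp-≗ (λ p → sym (perm-++ M (g₀ ∷ inverseWord M) p))
    (subst₂ (Swaps _) M-posL M-posR
      (swaps-conjugate (transp-swaps g₀) (perm M) (perm (inverseWord M)) (perm-inverseʳ M) (perm-inverseˡ M)))
    where
    M-posL : perm M (posL g₀) ≡ x
    M-posL = trans (perm-slide-start a d h (toℕ-posL g₀)) (Finₚ.toℕ-injective (toℕ-posL g₀))
    M-posR : perm M (posR g₀) ≡ y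
    M-posR = Finₚ.toℕ-injective (trans (toℕ-perm-slide-next a d h (toℕ-posR g₀)) (sym y≡1+a+d))

  act-swapWord : (Q : Quandle m) (s : Fin n → Fin m) → s x ≡ s y → act Q s swapWord ≗ s
  act-swapWord Q s sx≡sy p rewrite act-++ Q s M (g₀ ∷ inverseWord M) =
    trans (act-cong Q (inverseWord M) (act1-σ-equal Q a h₀ (act Q s M) equal) p) (act-inverse Q M s p)
    where
    equal : act Q s M (posL g₀) ≡ act Q s M (posR g₀)
    equal = begin
      act Q s M (posL g₀) ≡⟨ act-slide-start Q a d h s (toℕ-posL g₀) ⟩
      s (posL g₀)         ≡⟨ cong s (Finₚ.toℕ-injective (toℕ-posL g₀)) ⟩
      s x                 ≡⟨ sx≡sy ⟩
      s y                 ≡⟨ sym (act-slide-next Q a d h s (toℕ-posR g₀) y≡1+a+d) ⟩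
      act Q s M (posR g₀) ∎
      where open ≡-Reasoning

isInversion : (D : Fin n → Bool) (π : Fin n → Fin n) → Fin n → Fin n → Bool
isInversion D π x y = ⌊ x <? y ⌋ ∧ D x ∧ D y ∧ ⌊ π y <? π x ⌋

ends-conflict⇒∧≡false : ∀ p q r s → (p ≡ true → s ≡ true → ⊥) → p ∧ q ∧ r ∧ s ≡ false
ends-conflict⇒∧≡false false q     r     s     _ = refl
ends-conflict⇒∧≡false true  false r     s     _ = refl
ends-conflict⇒∧≡false true  true  false s     _ = refl
ends-conflict⇒∧≡false true  true  true  false _ = refl
ends-conflict⇒∧≡false true  true  true  true  conflict = ⊥-elim (conflict refl refl)

<?-true⁻¹ : {x y : Fin n} → ⌊ x <? y ⌋ ≡ true → x Fin.< y
<?-true⁻¹ {x = x} {y} = ⌊⌋-true⁻¹ (x <? y)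

<?-chain-conflict : {x y z : Fin n} → z Fin.< x → ⌊ x <? y ⌋ ≡ true → ⌊ y <? z ⌋ ≡ true → ⊥
<?-chain-conflict z<x x<y y<z =
  Finₚ.<-asym z<x (Finₚ.<-trans (<?-true⁻¹ x<y) (<?-true⁻¹ y<z))

inversionsOn-cong : (D : Fin n → Bool) {π π′ : Fin n → Fin n} → (∀ p → D p ≡ true → π p ≡ π′ p)
  → inversionsOn D π ≡ inversionsOn D π′
inversionsOn-cong D {π} {π′} π≡π′ = sumF-cong λ x → count-cong λ y → entry x y
  where
  entry : ∀ x y → isInversion D π x y ≡ isInversion D π′ x y
  entry x y with D x in Dx | D y in Dy
  ... | true  | true  rewrite π≡π′ x Dx | π≡π′ y Dy = refl
  ... | true  | false = refl
  ... | false | _     = refl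

inversionsOn-id : (D : Fin n → Bool) → inversionsOn D id ≡ 0
inversionsOn-id D = sumF-zero λ x → trans (count≡sumF (isInversion D id x)) (sumF-zero λ y →
  cong indicator (ends-conflict⇒∧≡false ⌊ x <? y ⌋ (D x) (D y) ⌊ y <? x ⌋ λ x<y y<x →
    Finₚ.<-asym (<?-true⁻¹ x<y) (<?-true⁻¹ y<x)))

-- Within D, the inversions of the transposition (a b) are (a, b) together with (a, y) and
-- (y, b) for each y ∈ D strictly between a and b.
module _ (D : Fin n → Bool) {π : Fin n → Fin n} {a b : Fin n} (a<b : a Fin.< b)
         (Da : D a ≡ true) (Db : D b ≡ true) (π-swaps : Swaps π a b) where
  open Swaps π-swaps renaming (image-x to πa; image-y to πb; fixes to πo)

  private
    between : Fin n → Bool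
    between y = ⌊ a <? y ⌋ ∧ D y ∧ ⌊ y <? b ⌋

    t : ℕ
    t = count between

    <?-irrefl : (x : Fin n) → ⌊ x <? x ⌋ ≡ false
    <?-irrefl x = ⌊⌋-false (x <? x) (Finₚ.<-irrefl refl)

    row-a : ∀ y → Dec (y ≡ a) → Dec (y ≡ b)
      → indicator (isInversion D π a y) ≡ indicator ⌊ y ≟ b ⌋ + indicator (between y)
    row-a .b _ (yes refl)
      rewrite ⌊⌋-true (b ≟ b) refl | Da | Db | πa | πb | ⌊⌋-true (a <? b) a<b | <?-irrefl b = refl
    row-a .a (yes refl) (no a≢b) rewrite ⌊⌋-false (a ≟ b) a≢b | <?-irrefl a = refl
    row-a y (no y≢a) (no y≢b) rewrite ⌊⌋-false (y ≟ b) y≢b | Da | πa | πo y y≢a y≢b = refl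

    row-b : ∀ y → Dec (y ≡ a) → Dec (y ≡ b) → isInversion D π b y ≡ false
    row-b .b _ (yes refl) rewrite <?-irrefl b = refl
    row-b .a (yes refl) (no _) rewrite ⌊⌋-false (b <? a) (Finₚ.<-asym a<b) = refl
    row-b y (no y≢a) (no y≢b) rewrite πb | πo y y≢a y≢b =
      ends-conflict⇒∧≡false ⌊ b <? y ⌋ (D b) (D y) ⌊ y <? a ⌋ (<?-chain-conflict a<b)

    row-other : ∀ x → x ≢ a → x ≢ b → ∀ y → y ≢ b → Dec (y ≡ a) → isInversion D π x y ≡ false
    row-other x x≢a x≢b .a _ (yes refl) rewrite πa | πo x x≢a x≢b =
      ends-conflict⇒∧≡false ⌊ x <? a ⌋ (D x) (D a) ⌊ b <? x ⌋ λ x<a b<x →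
        <?-chain-conflict a<b b<x x<a
    row-other x x≢a x≢b y y≢b (no y≢a) rewrite πo x x≢a x≢b | πo y y≢a y≢b =
      ends-conflict⇒∧≡false ⌊ x <? y ⌋ (D x) (D y) ⌊ y <? x ⌋ λ x<y y<x →
        Finₚ.<-asym (<?-true⁻¹ x<y) (<?-true⁻¹ y<x)

    count-row : ∀ x → Dec (x ≡ a) → Dec (x ≡ b)
      → count (isInversion D π x) ≡ (if ⌊ x ≟ a ⌋ then suc t else 0) + indicator (between x)
    count-row .a (yes refl) _ rewrite ⌊⌋-true (a ≟ a) refl | <?-irrefl a = begin
      count (isInversion D π a)
        ≡⟨ count≡sumF (isInversion D π a) ⟩
      sumF (indicator ∘ isInversion D π a)
        ≡⟨ sumF-cong (λ y → row-a y (y ≟ a) (y ≟ b)) ⟩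
      sumF (λ y → indicator ⌊ y ≟ b ⌋ + indicator (between y))
        ≡⟨ sumF-+ (λ y → indicator ⌊ y ≟ b ⌋) (indicator ∘ between) ⟩
      sumF (λ y → indicator ⌊ y ≟ b ⌋) + sumF (indicator ∘ between)
        ≡⟨ cong₂ _+_ (sumF-single b λ y y≢b → cong indicator (⌊⌋-false (y ≟ b) y≢b))
                     (sym (count≡sumF between)) ⟩
      indicator ⌊ b ≟ b ⌋ + t
        ≡⟨ cong (λ β → indicator β + t) (⌊⌋-true (b ≟ b) refl) ⟩
      suc t
        ≡⟨ ℕₚ.+-identityʳ _ ⟨
      suc t + 0
        ∎
      where open ≡-Reasoning
    count-row .b (no b≢a) (yes refl)
      rewrite ⌊⌋-false (b ≟ a) b≢a | <?-irrefl b | ∧-zeroʳ (D b) | ∧-zeroʳ ⌊ a <? b ⌋ =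
      trans (count≡sumF (isInversion D π b))
            (sumF-zero λ y → cong indicator (row-b y (y ≟ a) (y ≟ b)))
    count-row x (no x≢a) (no x≢b) rewrite ⌊⌋-false (x ≟ a) x≢a =
      trans (count≡sumF (isInversion D π x))
        (trans (sumF-single b λ y y≢b → cong indicator (row-other x x≢a x≢b y y≢b (y ≟ a)))
               (cong indicator entry-b))
      where
      entry-b : isInversion D π x b ≡ between x
      entry-b rewrite Db | πb | πo x x≢a x≢b =
        trans (∧-comm ⌊ x <? b ⌋ _)
          (trans (cong (_∧ ⌊ x <? b ⌋) (∧-comm (D x) _)) (∧-assoc ⌊ a <? x ⌋ (D x) _))

  inversionsOn-swap : inversionsOn D π ≡ suc (2 * count (λ y → ⌊ a <? y ⌋ ∧ D y ∧ ⌊ y <? b ⌋))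
  inversionsOn-swap = begin
    inversionsOn D π
      ≡⟨ sumF-cong (λ x → count-row x (x ≟ a) (x ≟ b)) ⟩
    sumF (λ x → (if ⌊ x ≟ a ⌋ then suc t else 0) + indicator (between x))
      ≡⟨ sumF-+ (λ x → if ⌊ x ≟ a ⌋ then suc t else 0) (indicator ∘ between) ⟩
    sumF (λ x → if ⌊ x ≟ a ⌋ then suc t else 0) + sumF (indicator ∘ between)
      ≡⟨ cong₂ _+_ (sumF-single a λ x x≢a →
                      cong (λ β → if β then suc t else 0) (⌊⌋-false (x ≟ a) x≢a))
                   (sym (count≡sumF between)) ⟩
    (if ⌊ a ≟ a ⌋ then suc t else 0) + t
      ≡⟨ cong (λ β → (if β then suc t else 0) + t) (⌊⌋-true (a ≟ a) refl) ⟩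
    suc (t + t)
      ≡⟨ cong (λ z → suc (t + z)) (ℕₚ.+-identityʳ t) ⟨
    suc (2 * t)
      ∎
    where open ≡-Reasoning

  inversionsOn-swap-odd : inversionsOn D π % 2 ≡ 1
  inversionsOn-swap-odd = begin
    inversionsOn D π % 2 ≡⟨ cong (_% 2) inversionsOn-swap ⟩
    suc (2 * t) % 2      ≡⟨ cong (λ z → suc z % 2) (ℕₚ.*-comm 2 t) ⟩
    suc (t * 2) % 2      ≡⟨ [m+kn]%n≡m%n 1 t 2 ⟩
    1                    ∎
    where open ≡-Reasoning

record ParityWitness (Q : Quandle m) (s : Fin n → Fin m) (D : Fin n → Bool) (e : Fin 2) : Set where
  field
    word       : BraidWord n
    stabilizes : act Q s word ≗ s
    supported  : ∀ p → D p ≡ false → perm word p ≡ p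
    parity     : inversionsOn D (perm word) % 2 ≡ toℕ e

parityWitness : (Q : Quandle m) (s : Fin n → Fin m) (D : Fin n → Bool) {a b : Fin n}
  → a Fin.< b → s a ≡ s b → D a ≡ true → D b ≡ true → (e : Fin 2) → ParityWitness Q s D e
parityWitness Q s D a<b sa≡sb Da Db zero = record
  { word       = []
  ; stabilizes = λ _ → refl
  ; supported  = λ _ _ → refl
  ; parity     = cong (_% 2) (inversionsOn-id D)
  }
parityWitness Q s D {a} {b} a<b sa≡sb Da Db (suc zero) = record
  { word       = swapWord a<b
  ; stabilizes = act-swapWord a<b Q s sa≡sb
  ; supported  = λ p Dp → Swaps.fixes (perm-swapWord a<b) p (outside Dp Da) (outside Dp Db)
  ; parity     = inversionsOn-swap-odd D a<b Da Db (perm-swapWord a<b)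
  }
  where
  outside : ∀ {p q} → D p ≡ false → D q ≡ true → p ≢ q
  outside Dp Dq refl with () ← trans (sym Dp) Dq

act-concat-stabilizes : (Q : Quandle m) (s : Fin n → Fin m) (ws : Fin k → BraidWord n)
  → (∀ i → act Q s (ws i) ≗ s) → act Q s (concat (tabulate ws)) ≗ s
act-concat-stabilizes {k = zero}  Q s ws stab p = refl
act-concat-stabilizes {k = suc k} Q s ws stab p
  rewrite act-++ Q s (ws zero) (concat (tabulate (ws ∘ suc))) =
    trans (act-cong Q (concat (tabulate (ws ∘ suc))) (stab zero) p)
          (act-concat-stabilizes Q s (ws ∘ suc) (stab ∘ suc) p)

perm-concat-outside : (c : Fin n → Fin k) (label : Fin k′ → Fin k) (ws : Fin k′ → BraidWord n)
  → (∀ i p → c p ≢ label i → perm (ws i) p ≡ p)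
  → ∀ p → (∀ i → c p ≢ label i) → perm (concat (tabulate ws)) p ≡ p
perm-concat-outside {k′ = zero}   c label ws supported p outside = refl
perm-concat-outside {k′ = suc k′} c label ws supported p outside =
  trans (perm-++ (ws zero) (concat (tabulate (ws ∘ suc))) p)
    (trans (cong (perm (ws zero))
                 (perm-concat-outside c (label ∘ suc) (ws ∘ suc) (supported ∘ suc) p (outside ∘ suc)))
           (supported zero p (outside zero)))

perm-concat-inside : (c : Fin n → Fin k) (label : Fin k′ → Fin k) (ws : Fin k′ → BraidWord n)
  → Injective _≡_ _≡_ label
  → (∀ i p → c p ≢ label i → perm (ws i) p ≡ p)
  → (∀ i p → c (perm (ws i) p) ≡ c p)
  → ∀ i p → c p ≡ label i → perm (concat (tabulate ws)) p ≡ perm (ws i) p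
perm-concat-inside c label ws label-inj supported preserves zero p cp≡label₀ =
  trans (perm-++ (ws zero) (concat (tabulate (ws ∘ suc))) p)
    (cong (perm (ws zero)) (perm-concat-outside c (label ∘ suc) (ws ∘ suc) (supported ∘ suc) p
      λ i cp≡labelᵢ → Finₚ.0≢1+n (label-inj (trans (sym cp≡label₀) cp≡labelᵢ))))
perm-concat-inside c label ws label-inj supported preserves (suc i) p cp≡labelᵢ =
  trans (perm-++ (ws zero) (concat (tabulate (ws ∘ suc))) p)
    (trans (cong (perm (ws zero)) rest)
           (supported zero _ λ e →
              Finₚ.0≢1+n (label-inj (trans (sym e) (trans (preserves (suc i) p) cp≡labelᵢ)))))
  where
  rest : perm (concat (tabulate (ws ∘ suc))) p ≡ perm (ws (suc i)) p
  rest = perm-concat-inside c (label ∘ suc) (ws ∘ suc) (Finₚ.suc-injective ∘ label-inj)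
                            (supported ∘ suc) (preserves ∘ suc) i p cp≡labelᵢ

inversionsOn-concat : (c : Fin n → Fin k) (ws : Fin k → BraidWord n)
  → (∀ j p → c p ≢ j → perm (ws j) p ≡ p)
  → (∀ j p → c (perm (ws j) p) ≡ c p)
  → ∀ j → inversionsOn (λ p → ⌊ c p ≟ j ⌋) (perm (concat (tabulate ws)))
        ≡ inversionsOn (λ p → ⌊ c p ≟ j ⌋) (perm (ws j))
inversionsOn-concat c ws supported preserves j = inversionsOn-cong _ λ p cp≡j →
  perm-concat-inside c id ws id supported preserves j p (⌊⌋-true⁻¹ (c p ≟ j) cp≡j)

mainTheorem16 : ∀ {m} (Q : Quandle m) (k : ℕ) (comp : Fin m → Fin k)
    → IsComponentLabelling Q k comp
    → ∀ {n} (s : Fin n → Fin m)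
    → (∀ j → maxF (λ j′ → count (λ x → ⌊ comp x ≟ j′ ⌋)) < count (λ i → ⌊ comp (s i) ≟ j ⌋))
    → (ε : Fin k → Fin 2)
    → ∃ λ (w : BraidWord n)
        → (∀ p → act Q s w p ≡ s p)
        × (∀ p → comp (s (perm w p)) ≡ comp (s p))
        × (∀ j → inversionsOn (λ i → ⌊ comp (s i) ≟ j ⌋) (perm w) % 2 ≡ toℕ (ε j))
mainTheorem16 Q k comp labelling s crowded ε =
  W , stabilizes-W , stabilizer-preserves-components Q labelling s W stabilizes-W , parity-W
  where
  D : Fin k → Fin _ → Bool
  D j i = ⌊ comp (s i) ≟ j ⌋

  witness : ∀ j → ParityWitness Q s (D j) (ε j)
  witness j with a , b , a<b , sa≡sb , Da ← pigeonhole-count s (λ x → ⌊ comp x ≟ j ⌋)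
                   (ℕₚ.≤-<-trans (≤-maxF (λ j′ → count (λ x → ⌊ comp x ≟ j′ ⌋)) j) (crowded j))
    = parityWitness Q s (D j) a<b sa≡sb Da (trans (cong (λ x → ⌊ comp x ≟ j ⌋) (sym sa≡sb)) Da) (ε j)

  open ParityWitness

  W : BraidWord _
  W = concat (tabulate (word ∘ witness))

  stabilizes-W : act Q s W ≗ s
  stabilizes-W = act-concat-stabilizes Q s (word ∘ witness) (stabilizes ∘ witness)

  parity-W : ∀ j → inversionsOn (D j) (perm W) % 2 ≡ toℕ (ε j)
  parity-W j = trans (cong (_% 2) (inversionsOn-concat (comp ∘ s) (word ∘ witness)
      (λ i p cp≢i → supported (witness i) p (⌊⌋-false (comp (s p) ≟ i) cp≢i))
      (λ i → stabilizer-preserves-components Q labelling s (word (witness i)) (stabilizes (witness i)))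
      j))
    (parity (witness j))
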